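{- Let $\Lambda$ be an Eulerian lattice of rank $n$ and $\nu\in\Lambda$ with $\hat0<\nu<\hat1$. Let $\Lambda_\nu=\{\sigma\in\Lambda:\sigma\vee\nu<\hat1\}$ with the order induced from $\Lambda$. Then the $\mathbf a\mathbf b$-index of $\Lambda_\nu$ is \[\Psi_{\Lambda_\nu}=\sum_{\nu\le\pi<\hat1}\Psi_{[\hat0,\pi)}\cdot\mathbf a\cdot(\mathbf b-\mathbf a)^{\rho(\pi,\hat1)-1}.\]
   Context: Conventions: all posets are finite and graded, have a minimum $\hat0$ of rank $0$, and need not have a maximum. $\rho$ is rank, $\rho(x,y)=\rho(y)-\rho(x)$. For $\Lambda$ of rank $n$, $\hat1$ is a formally adjoined maximum of rank $n+1$; $\Lambda$ is a lattice if $\Lambda\cup\{\hat1\}$ is a lattice, and $\vee$ is the join in $\Lambda\cup\{\hat1\}$. $\Lambda$ is Eulerian if for all $\tau<\pi$ in $\Lambda\cup\{\hat1\}$, $\sum_{\tau\le\sigma\le\pi}(-1)^{\rho(\tau,\sigma)}=0$. $\mathbf{a}\mathbf{b}$-index: for a subposet $P$ (containing $\hat0$) of a graded poset with top $\hat1$, and a chain $x=\{\hat0=\sigma_0<\sigma_1<\cdots<\sigma_k\}$ in $P$, $\mathrm{wt}(x)=(\mathbf a-\mathbf b)^{\rho(\sigma_0,\sigma_1)-1}\mathbf b(\mathbf a-\mathbf b)^{\rho(\sigma_1,\sigma_2)-1}\mathbf b\cdots\mathbf b(\mathbf a-\mathbf b)^{\rho(\sigma_k,\hat1)-1}$ in noncommuting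 $\mathbf a,\mathbf b$, and $\Psi_P=\sum_x\mathrm{wt}(x)$ over all such chains ($k\ge0$). For $\Lambda_\nu$ the top is the $\hat1$ of $\Lambda$ (rank $n+1$); for the interval $[\hat0,\pi)=\{\sigma:\sigma<\pi\}$ the top is $\pi$. -}

module Defs where

open import Data.Bool using (Bool; true; false; T; _∧_; _∨_; not; if_then_else_)
open import Data.Nat as ℕ using (ℕ; zero; suc; _∸_)
open import Data.Integer as ℤ using (ℤ; +_; -_)
open import Data.Fin using (Fin)
open import Data.Fin.Properties using () renaming (_≟_ to _≟F_)
open import Data.List using (List; []; _∷_; _++_; map; concatMap; foldr; upTo)
open import Data.Bool.ListAction using (all; any)
open import Data.List.Base using (allFin)
open import Data.Vec using (Vec; []; _∷_; lookup)
open import Data.Product using (_×_; _,_; Σ)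
open import Data.Empty using (⊥)
open import Relation.Nullary using (¬_; does)
open import Relation.Binary.PropositionalEquality using (_≡_; _≢_)

-- Noncommutative polynomials in a, b with integer coefficients,
-- as finite formal sums of (coefficient , word).

data Letter : Set where
  𝐚 𝐛 : Letter

Word : Set
Word = List Letter

letterEq : Letter → Letter → Bool
letterEq 𝐚 𝐚 = true
letterEq 𝐛 𝐛 = true
letterEq _ _ = false

wordEq : Word → Word → Bool
wordEq [] [] = true
wordEq (x ∷ xs) (y ∷ ys) = letterEq x y ∧ wordEq xs ys
wordEq _ _ = false

Poly : Set
Poly = List (ℤ × Word)

0P : Poly
0P = []

1P : Poly
1P = (+ 1 , []) ∷ []

aP bP : Poly
aP = (+ 1 , 𝐚 ∷ []) ∷ []
bP = (+ 1 , 𝐛 ∷ []) ∷ []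

_+P_ : Poly → Poly → Poly
p +P q = p ++ q

negP : Poly → Poly
negP = map (λ { (c , w) → (- c , w) })

_-P_ : Poly → Poly → Poly
p -P q = p +P negP q

_*P_ : Poly → Poly → Poly
p *P q = concatMap (λ { (c , w) → map (λ { (d , v) → (c ℤ.* d , w ++ v) }) q }) p

_^P_ : Poly → ℕ → Poly
p ^P zero = 1P
p ^P suc k = p *P (p ^P k)

sumP : List Poly → Poly
sumP = foldr _+P_ 0P

coeff : Poly → Word → ℤ
coeff [] w = + 0
coeff ((c , v) ∷ p) w = (if wordEq v w then c else + 0) ℤ.+ coeff p w

_≈P_ : Poly → Poly → Set
p ≈P q = ∀ w → coeff p w ≡ coeff q w

record FinPoset : Set where
  field
    m     : ℕ
    leq   : Fin m → Fin m → Bool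
    bot   : Fin m
    rank  : Fin m → ℕ

module _ (P : FinPoset) where
  open FinPoset P

  _≤_ : Fin m → Fin m → Set
  x ≤ y = T (leq x y)

  _<_ : Fin m → Fin m → Set
  x < y = x ≤ y × x ≢ y

  _⋖_ : Fin m → Fin m → Set
  x ⋖ y = x < y × (∀ z → x < z → z < y → ⊥)

  -- Λ is a partial order with minimum bot, graded by rank, of rank n
  -- (every maximal element has rank n, so that Λ ∪ {1̂} is graded with
  -- ρ(1̂) = n + 1).
  record IsGradedPoset (n : ℕ) : Set where
    field
      refl≤    : ∀ x → x ≤ x
      antisym≤ : ∀ x y → x ≤ y → y ≤ x → x ≡ y
      trans≤   : ∀ x y z → x ≤ y → y ≤ z → x ≤ z
      bot-min  : ∀ x → bot ≤ x
      rank-bot : rank bot ≡ 0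
      rank-cov : ∀ x y → x ⋖ y → rank y ≡ suc (rank x)
      rank-max : ∀ x → (∀ y → x ≤ y → y ≡ x) → rank x ≡ n

  data Ext : Set where
    el  : Fin m → Ext
    top : Ext

  leqE : Ext → Ext → Bool
  leqE (el x) (el y) = leq x y
  leqE _      top    = true
  leqE top    (el _) = false

  _≤E_ : Ext → Ext → Set
  x ≤E y = T (leqE x y)

  _<E_ : Ext → Ext → Set
  x <E y = x ≤E y × x ≢ y

  rankE : ℕ → Ext → ℕ
  rankE n (el x) = rank x
  rankE n top    = suc n

  allExt : List Ext
  allExt = top ∷ map el (allFin m)

  record IsLattice : Set where
    field
      join     : Ext → Ext → Ext
      meet     : Ext → Ext → Ext
      join-ubˡ : ∀ x y → x ≤E join x y
      join-ubʳ : ∀ x y → y ≤E join x y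
      join-lub : ∀ x y z → x ≤E z → y ≤E z → join x y ≤E z
      meet-lbˡ : ∀ x y → meet x y ≤E x
      meet-lbʳ : ∀ x y → meet x y ≤E y
      meet-glb : ∀ x y z → z ≤E x → z ≤E y → z ≤E meet x y

  sign : ℕ → ℤ
  sign zero = + 1
  sign (suc k) = - sign k

  eulerSum : ℕ → Ext → Ext → ℤ
  eulerSum n τ π = foldr ℤ._+_ (+ 0)
    (map (λ σ → if leqE τ σ ∧ leqE σ π then sign (rankE n σ ∸ rankE n τ) else + 0) allExt)

  IsEulerian : ℕ → Set
  IsEulerian n = ∀ τ π → τ <E π → eulerSum n τ π ≡ + 0

  -- ab-index of a subposet Q ⊆ Λ (given by a Boolean predicate,
  -- containing bot) with respect to a top of rank N.

  subsets : (k : ℕ) → List (Vec Bool k)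
  subsets zero = [] ∷ []
  subsets (suc k) = concatMap (λ v → (true ∷ v) ∷ (false ∷ v) ∷ []) (subsets k)

  allF : (Fin m → Bool) → Bool
  allF f = all f (allFin m)

  isChainIn : (Fin m → Bool) → Vec Bool m → Bool
  isChainIn Q S =
    lookup S bot ∧
    allF (λ x → not (lookup S x) ∨ Q x) ∧
    allF (λ x → allF (λ y → not (lookup S x ∧ lookup S y) ∨ (leq x y ∨ leq y x)))

  chainRanks : ℕ → Vec Bool m → List ℕ
  chainRanks N S = Data.List.filterᵇ
    (λ i → any (λ x → lookup S x ∧ does (rank x ℕ.≟ i)) (allFin m)) (upTo N)

  a-b : Poly
  a-b = aP -P bP

  -- wt = (a-b)^{ρ(σ₀,σ₁)-1} b (a-b)^{ρ(σ₁,σ₂)-1} b ⋯ b (a-b)^{ρ(σ_k,top)-1}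
  wtRanks : ℕ → List ℕ → Poly
  wtRanks N [] = 0P
  wtRanks N (r ∷ rs) = go r rs
    where
    go : ℕ → List ℕ → Poly
    go prev [] = a-b ^P (N ∸ prev ∸ 1)
    go prev (s ∷ ss) = (a-b ^P (s ∸ prev ∸ 1)) *P (bP *P go s ss)

  Ψ : (Fin m → Bool) → ℕ → Poly
  Ψ Q N = sumP (map (λ S → if isChainIn Q S then wtRanks N (chainRanks N S) else 0P) (subsets m))

  isTop : Ext → Bool
  isTop top = true
  isTop (el _) = false

  Λ_ : IsLattice → Fin m → (Fin m → Bool)
  Λ_ L ν σ = not (isTop (IsLattice.join L (el σ) (el ν)))

  below : Fin m → (Fin m → Bool)
  below π σ = leq σ π ∧ not (does (σ ≟F π))

  rhs : ℕ → Fin m → Poly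
  rhs n ν = sumP (map (λ π → if leq ν π
      then Ψ (below π) (rank π) *P (aP *P ((bP -P aP) ^P (suc n ∸ rank π ∸ 1)))
      else 0P) (allFin m))

module Submission where

-- Expand Ψ_{Λ_ν} as a sum over the chains S of Λ. If τ is the top of S, the Eulerian relation on
-- [τ ∨ ν, 1̂] shows that Σ_{π ≥ τ, ν} (−1)^{ρ(π,1̂)−1} is 1 when τ ∨ ν < 1̂, i.e. when S ⊆ Λ_ν, and 0
-- otherwise. Exchanging the two sums leaves, for each π ≥ ν, (−1)^{ρ(π,1̂)−1} times the total weight
-- of the chains of [0̂, π]. These are the chains c of [0̂, π) together with the chains c ∪ {π}, and
-- a = (a − b) + b and b − a = −(a − b) give wt_π(c) · a(b − a)^k = (−1)^k (wt(c) + wt(c ∪ {π})).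

open import Defs
open import Data.Bool using (Bool; true; false; T; _∧_; _∨_; not; if_then_else_)
open import Data.Bool.ListAction using (any)
open import Data.Bool.Properties using (T-∧; T-∨; ∧-comm; ∧-zeroʳ)
open import Data.Empty using (⊥-elim)
open import Data.Fin using (Fin; zero; suc)
open import Data.Fin.Induction using (spo-wellFounded; spo-noetherian)
import Data.Fin.Properties as Fin
open import Data.Integer using (ℤ; +_; -_; _+_; _*_)
import Data.Integer.Properties as ℤ
open import Data.Integer.Tactic.RingSolver using (solve-∀)
open import Data.List using (List; []; _∷_; _++_; _∷ʳ_; map; concatMap; foldr; allFin; filterᵇ; upTo)
open import Data.List.Membership.Propositional using (_∈_; lose)
open import Data.List.Membership.Propositional.Properties using (∈-allFin)
import Data.List.Properties as List
open import Data.List.Relation.Unary.All as All using (All; []; _∷_)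
open import Data.List.Relation.Unary.All.Properties using (all⁺; all⁻; all-upTo; filter⁺)
open import Data.List.Relation.Unary.Any as Any using (here; there)
open import Data.List.Relation.Unary.Any.Properties using (any⁺; any⁻)
open import Data.Maybe using (Maybe; just; nothing; maybe′)
open import Data.Nat as ℕ using (ℕ; zero; suc; _∸_)
import Data.Nat.Properties as ℕ
open import Data.Product using (_×_; _,_; proj₁; proj₂; Σ-syntax)
open import Data.Sum using (_⊎_; inj₁; inj₂; [_,_]′)
open import Data.Unit using (tt)
open import Data.Vec using (Vec; _∷_; lookup; _[_]≔_)
import Data.Vec.Properties as Vec
open import Function using (_∘_; _⇔_; Equivalence; mk⇔)
open import Induction.WellFounded using (Acc; acc)
open import Level using (0ℓ)
open import Relation.Binary.Bundles using (Setoid)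
open import Relation.Binary.PropositionalEquality
import Relation.Binary.Reasoning.Setoid as SetoidReasoning
open import Relation.Binary.Structures using (IsStrictPartialOrder)
open import Relation.Nullary using (¬_; Dec; yes; no; does)
open import Relation.Nullary.Decidable using (_×-dec_; ¬?; T?)

open Equivalence using (to; from)

-- Noncommutative polynomials up to equality of coefficients

coeff-+P : ∀ p q w → coeff (p +P q) w ≡ coeff p w + coeff q w
coeff-+P [] q w = sym (ℤ.+-identityˡ _)
coeff-+P ((c , v) ∷ p) q w =
  trans (cong (_+_ cᵥ) (coeff-+P p q w)) (sym (ℤ.+-assoc cᵥ (coeff p w) (coeff q w)))
  where cᵥ = if wordEq v w then c else + 0

coeff-negP : ∀ p w → coeff (negP p) w ≡ - coeff p w
coeff-negP [] w = refl
coeff-negP ((c , v) ∷ p) w =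
  trans (cong₂ _+_ (if-neg (wordEq v w)) (coeff-negP p w)) (sym (ℤ.neg-distrib-+ cᵥ (coeff p w)))
  where
  if-neg : ∀ b → (if b then - c else + 0) ≡ - (if b then c else + 0)
  if-neg true  = refl
  if-neg false = refl
  cᵥ = if wordEq v w then c else + 0

infix 4 _≃_

-- Unlike _≈P_, a record type determines both polynomials, so they can be inferred.
record _≃_ (p q : Poly) : Set where
  constructor mk≃
  field coeff-≡ : p ≈P q

open _≃_

≃-setoid : Setoid 0ℓ 0ℓ
≃-setoid = record
  { Carrier = Poly
  ; _≈_ = _≃_
  ; isEquivalence = record
    { refl = mk≃ λ _ → refl
    ; sym = λ (mk≃ e) → mk≃ λ w → sym (e w)
    ; trans = λ (mk≃ e) (mk≃ f) → mk≃ λ w → trans (e w) (f w)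
    }
  }

open Setoid ≃-setoid using () renaming (refl to ≃-refl; reflexive to ≡⇒≃)
module ≃-Reasoning = SetoidReasoning ≃-setoid

+P-cong : ∀ {p p′ q q′} → p ≃ p′ → q ≃ q′ → (p +P q) ≃ (p′ +P q′)
+P-cong {p} {p′} {q} {q′} (mk≃ e) (mk≃ f) = mk≃ λ w → begin
  coeff (p +P q) w           ≡⟨ coeff-+P p q w ⟩
  coeff p w + coeff q w      ≡⟨ cong₂ _+_ (e w) (f w) ⟩
  coeff p′ w + coeff q′ w    ≡⟨ coeff-+P p′ q′ w ⟨
  coeff (p′ +P q′) w         ∎
  where open ≡-Reasoning

negP-cong : ∀ {p q} → p ≃ q → negP p ≃ negP q
negP-cong {p} {q} (mk≃ e) = mk≃ λ w →
  trans (coeff-negP p w) (trans (cong -_ (e w)) (sym (coeff-negP q w)))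

negP-+P : ∀ p q → negP (p +P q) ≡ negP p +P negP q
negP-+P = List.map-++ _

-- ((c , u) ∷ p) *P q unfolds definitionally to monomial*P c u q +P (p *P q).
monomial*P : ℤ → Word → Poly → Poly
monomial*P c u = map λ (d , v) → (c * d , u ++ v)

*P-distribʳ-+P : ∀ p q r → (p +P q) *P r ≡ (p *P r) +P (q *P r)
*P-distribʳ-+P []            q r = refl
*P-distribʳ-+P ((c , u) ∷ p) q r =
  trans (cong (monomial*P c u r ++_) (*P-distribʳ-+P p q r))
        (sym (List.++-assoc (monomial*P c u r) (p *P r) (q *P r)))

monomial*P-*P : ∀ c u q r → monomial*P c u q *P r ≡ monomial*P c u (q *P r)
monomial*P-*P c u []            r = refl
monomial*P-*P c u ((d , v) ∷ q) r = begin
  monomial*P (c * d) (u ++ v) r ++ (monomial*P c u q *P r)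
    ≡⟨ cong₂ _++_ monomial-assoc (monomial*P-*P c u q r) ⟩
  monomial*P c u (monomial*P d v r) ++ monomial*P c u (q *P r)
    ≡⟨ List.map-++ _ (monomial*P d v r) (q *P r) ⟨
  monomial*P c u (monomial*P d v r ++ (q *P r)) ∎
  where
  open ≡-Reasoning
  monomial-assoc : monomial*P (c * d) (u ++ v) r ≡ monomial*P c u (monomial*P d v r)
  monomial-assoc = trans (List.map-cong (λ (e , x) → cong₂ _,_ (ℤ.*-assoc c d e) (List.++-assoc u v x)) r)
                         (List.map-∘ r)

*P-assoc : ∀ p q r → (p *P q) *P r ≡ p *P (q *P r)
*P-assoc []            q r = refl
*P-assoc ((c , u) ∷ p) q r = begin
  (monomial*P c u q ++ (p *P q)) *P r           ≡⟨ *P-distribʳ-+P (monomial*P c u q) (p *P q) r ⟩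
  (monomial*P c u q *P r) ++ ((p *P q) *P r)   ≡⟨ cong₂ _++_ (monomial*P-*P c u q r) (*P-assoc p q r) ⟩
  monomial*P c u (q *P r) ++ (p *P (q *P r))   ∎
  where open ≡-Reasoning

1P-*P : ∀ q → 1P *P q ≡ q
1P-*P q = trans (List.++-identityʳ _)
                (trans (List.map-cong (λ (d , v) → cong (_, v) (ℤ.*-identityˡ d)) q) (List.map-id q))

negP-*P : ∀ p q → negP p *P q ≡ negP (p *P q)
negP-*P []            q = refl
negP-*P ((c , u) ∷ p) q = begin
  monomial*P (- c) u q ++ (negP p *P q)          ≡⟨ cong₂ _++_ negate-monomial (negP-*P p q) ⟩
  negP (monomial*P c u q) ++ negP (p *P q)       ≡⟨ negP-+P (monomial*P c u q) (p *P q) ⟨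
  negP (monomial*P c u q ++ (p *P q))            ∎
  where
  open ≡-Reasoning
  negate-monomial : monomial*P (- c) u q ≡ negP (monomial*P c u q)
  negate-monomial = trans (List.map-cong (λ (d , v) → cong (_, u ++ v) (sym (ℤ.neg-distribˡ-* c d))) q)
                          (List.map-∘ q)

*P-negPʳ : ∀ p q → p *P negP q ≡ negP (p *P q)
*P-negPʳ []            q = refl
*P-negPʳ ((c , u) ∷ p) q = begin
  monomial*P c u (negP q) ++ (p *P negP q)       ≡⟨ cong₂ _++_ monomial-negate (*P-negPʳ p q) ⟩
  negP (monomial*P c u q) ++ negP (p *P q)       ≡⟨ negP-+P (monomial*P c u q) (p *P q) ⟨
  negP (monomial*P c u q ++ (p *P q))            ∎
  where
  open ≡-Reasoning
  monomial-negate : monomial*P c u (negP q) ≡ negP (monomial*P c u q)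
  monomial-negate = trans (sym (List.map-∘ q))
    (trans (List.map-cong (λ (d , v) → cong (_, u ++ v) (sym (ℤ.neg-distribʳ-* c d))) q) (List.map-∘ q))

+P-interchange : ∀ p q r s → ((p +P q) +P (r +P s)) ≃ ((p +P r) +P (q +P s))
+P-interchange p q r s = mk≃ λ w → begin
  coeff ((p +P q) +P (r +P s)) w                          ≡⟨ expand p q r s w ⟩
  (coeff p w + coeff q w) + (coeff r w + coeff s w)      ≡⟨ interchange (coeff p w) (coeff q w) (coeff r w) (coeff s w) ⟩
  (coeff p w + coeff r w) + (coeff q w + coeff s w)      ≡⟨ expand p r q s w ⟨
  coeff ((p +P r) +P (q +P s)) w                          ∎
  where
  open ≡-Reasoning
  expand : ∀ p q r s w →
    coeff ((p +P q) +P (r +P s)) w ≡ (coeff p w + coeff q w) + (coeff r w + coeff s w)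
  expand p q r s w = trans (coeff-+P (p +P q) (r +P s) w) (cong₂ _+_ (coeff-+P p q w) (coeff-+P r s w))
  interchange : ∀ a b c d → (a + b) + (c + d) ≡ (a + c) + (b + d)
  interchange = solve-∀

dropPrefix : Word → Word → Maybe Word
dropPrefix []      x        = just x
dropPrefix (l ∷ u) []       = nothing
dropPrefix (l ∷ u) (l′ ∷ x) = if letterEq l l′ then dropPrefix u x else nothing

wordEq-++ : ∀ u v x → wordEq (u ++ v) x ≡ maybe′ (wordEq v) false (dropPrefix u x)
wordEq-++ []      v x        = refl
wordEq-++ (l ∷ u) v []       = refl
wordEq-++ (l ∷ u) v (l′ ∷ x) with letterEq l l′
... | true  = wordEq-++ u v x
... | false = refl

coeff-monomial*P : ∀ c u q x →
  coeff (monomial*P c u q) x ≡ maybe′ (λ y → c * coeff q y) (+ 0) (dropPrefix u x)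
coeff-monomial*P c u [] x with dropPrefix u x
... | just y  = sym (ℤ.*-zeroʳ c)
... | nothing = refl
coeff-monomial*P c u ((d , v) ∷ q) x
  rewrite coeff-monomial*P c u q x | wordEq-++ u v x with dropPrefix u x
... | just y  = trans (cong (_+ (c * coeff q y)) (if-* (wordEq v y)))
                      (sym (ℤ.*-distribˡ-+ c (if wordEq v y then d else + 0) (coeff q y)))
  where
  if-* : ∀ b → (if b then c * d else + 0) ≡ c * (if b then d else + 0)
  if-* true  = refl
  if-* false = sym (ℤ.*-zeroʳ c)
... | nothing = refl

monomial*P-cong : ∀ c u {q q′} → q ≃ q′ → monomial*P c u q ≃ monomial*P c u q′
monomial*P-cong c u {q} {q′} (mk≃ e) = mk≃ λ x →
  trans (coeff-monomial*P c u q x) (trans (cong-dropPrefix (dropPrefix u x)) (sym (coeff-monomial*P c u q′ x)))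
  where
  cong-dropPrefix : ∀ m → maybe′ (λ y → c * coeff q y) (+ 0) m ≡ maybe′ (λ y → c * coeff q′ y) (+ 0) m
  cong-dropPrefix (just y) = cong (c *_) (e y)
  cong-dropPrefix nothing  = refl

*P-congˡ : ∀ p {q q′} → q ≃ q′ → (p *P q) ≃ (p *P q′)
*P-congˡ []            e = ≃-refl
*P-congˡ ((c , u) ∷ p) e = +P-cong (monomial*P-cong c u e) (*P-congˡ p e)

*P-distribˡ-+P : ∀ p q r → (p *P (q +P r)) ≃ ((p *P q) +P (p *P r))
*P-distribˡ-+P []            q r = ≃-refl
*P-distribˡ-+P ((c , u) ∷ p) q r = begin
  monomial*P c u (q ++ r) ++ (p *P (q +P r))
    ≈⟨ +P-cong (≡⇒≃ (List.map-++ _ q r)) (*P-distribˡ-+P p q r) ⟩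
  (monomial*P c u q ++ monomial*P c u r) ++ ((p *P q) ++ (p *P r))
    ≈⟨ +P-interchange (monomial*P c u q) (monomial*P c u r) (p *P q) (p *P r) ⟩
  (monomial*P c u q ++ (p *P q)) ++ (monomial*P c u r ++ (p *P r)) ∎
  where open ≃-Reasoning

^P-+ : ∀ p e f → ((p ^P e) *P (p ^P f)) ≡ p ^P (e ℕ.+ f)
^P-+ p zero    f = 1P-*P (p ^P f)
^P-+ p (suc e) f = trans (*P-assoc p (p ^P e) (p ^P f)) (cong (p *P_) (^P-+ p e f))

signed : ℕ → Poly → Poly
signed zero    p = p
signed (suc k) p = negP (signed k p)

signed-cong : ∀ k {p q} → p ≃ q → signed k p ≃ signed k q
signed-cong zero    e = e
signed-cong (suc k) e = negP-cong (signed-cong k e)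

signed-negP : ∀ k p → signed k (negP p) ≡ negP (signed k p)
signed-negP zero    p = refl
signed-negP (suc k) p = cong negP (signed-negP k p)

*P-signedʳ : ∀ k p q → (p *P signed k q) ≡ signed k (p *P q)
*P-signedʳ zero    p q = refl
*P-signedʳ (suc k) p q = trans (*P-negPʳ p (signed k q)) (cong negP (*P-signedʳ k p q))

coeff-signed : ∀ P k p w → coeff (signed k p) w ≡ sign P k * coeff p w
coeff-signed P zero    p w = sym (ℤ.*-identityˡ (coeff p w))
coeff-signed P (suc k) p w = begin
  coeff (negP (signed k p)) w   ≡⟨ coeff-negP (signed k p) w ⟩
  - coeff (signed k p) w        ≡⟨ cong -_ (coeff-signed P k p w) ⟩
  - (sign P k * coeff p w)      ≡⟨ ℤ.neg-distribˡ-* (sign P k) (coeff p w) ⟩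
  - sign P k * coeff p w        ∎
  where open ≡-Reasoning

coeff-−P-*P : ∀ p q r w → coeff ((p -P q) *P r) w ≡ coeff (p *P r) w + - coeff (q *P r) w
coeff-−P-*P p q r w = begin
  coeff ((p -P q) *P r) w                    ≡⟨ cong (λ s → coeff s w) distribute ⟩
  coeff ((p *P r) +P negP (q *P r)) w        ≡⟨ coeff-+P (p *P r) (negP (q *P r)) w ⟩
  coeff (p *P r) w + coeff (negP (q *P r)) w ≡⟨ cong (_+_ (coeff (p *P r) w)) (coeff-negP (q *P r) w) ⟩
  coeff (p *P r) w + - coeff (q *P r) w      ∎
  where
  open ≡-Reasoning
  distribute : ((p -P q) *P r) ≡ ((p *P r) +P negP (q *P r))
  distribute = trans (*P-distribʳ-+P p (negP q) r) (cong ((p *P r) +P_) (negP-*P q r))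

[b-a]*P : ∀ r → ((bP -P aP) *P r) ≃ negP ((aP -P bP) *P r)
[b-a]*P r = mk≃ λ w → begin
  coeff ((bP -P aP) *P r) w                      ≡⟨ coeff-−P-*P bP aP r w ⟩
  coeff (bP *P r) w + - coeff (aP *P r) w        ≡⟨ swap (coeff (aP *P r) w) (coeff (bP *P r) w) ⟩
  - (coeff (aP *P r) w + - coeff (bP *P r) w)    ≡⟨ cong -_ (coeff-−P-*P aP bP r w) ⟨
  - coeff ((aP -P bP) *P r) w                    ≡⟨ coeff-negP ((aP -P bP) *P r) w ⟨
  coeff (negP ((aP -P bP) *P r)) w               ∎
  where
  open ≡-Reasoning
  swap : ∀ x y → y + - x ≡ - (x + - y)
  swap = solve-∀

a*P-split : ∀ r → (aP *P r) ≃ (((aP -P bP) *P r) +P (bP *P r))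
a*P-split r = mk≃ λ w → begin
  coeff (aP *P r) w                                           ≡⟨ cancel (coeff (aP *P r) w) (coeff (bP *P r) w) ⟩
  (coeff (aP *P r) w + - coeff (bP *P r) w) + coeff (bP *P r) w ≡⟨ cong (_+ coeff (bP *P r) w) (coeff-−P-*P aP bP r w) ⟨
  coeff ((aP -P bP) *P r) w + coeff (bP *P r) w               ≡⟨ coeff-+P ((aP -P bP) *P r) (bP *P r) w ⟨
  coeff (((aP -P bP) *P r) +P (bP *P r)) w                    ∎
  where
  open ≡-Reasoning
  cancel : ∀ x y → x ≡ (x + - y) + y
  cancel = solve-∀

[b-a]^P : ∀ k → ((bP -P aP) ^P k) ≃ signed k ((aP -P bP) ^P k)
[b-a]^P zero    = ≃-refl
[b-a]^P (suc k) = begin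
  (bP -P aP) *P ((bP -P aP) ^P k)           ≈⟨ *P-congˡ (bP -P aP) ([b-a]^P k) ⟩
  (bP -P aP) *P signed k ((aP -P bP) ^P k)  ≡⟨ *P-signedʳ k (bP -P aP) ((aP -P bP) ^P k) ⟩
  signed k ((bP -P aP) *P ((aP -P bP) ^P k)) ≈⟨ signed-cong k ([b-a]*P ((aP -P bP) ^P k)) ⟩
  signed k (negP ((aP -P bP) ^P suc k))     ≡⟨ signed-negP k ((aP -P bP) ^P suc k) ⟩
  signed (suc k) ((aP -P bP) ^P suc k)      ∎
  where open ≃-Reasoning

∸-+-suc-∸1 : ∀ r N′ k → r ℕ.< N′ → N′ ℕ.+ suc k ∸ r ∸ 1 ≡ (N′ ∸ r ∸ 1) ℕ.+ suc k
∸-+-suc-∸1 zero    (suc N′) k _               = refl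
∸-+-suc-∸1 (suc r) (suc N′) k (ℕ.s≤s r<N′) = ∸-+-suc-∸1 r N′ k r<N′

-- r ∷ rs lists the ranks of a chain c of [0̂, π), with ρ(π) = N′ and ρ(1̂) = N′ + 1 + k;
-- the right side is (−1)^k (wt(c) + wt(c ∪ {π})).
wtRanks-*P-a[b-a]^ : ∀ P {N′ k N} → N′ ℕ.+ suc k ≡ N → ∀ r rs → r ℕ.< N′ → All (ℕ._< N′) rs →
  (wtRanks P N′ (r ∷ rs) *P (aP *P ((bP -P aP) ^P k)))
    ≃ signed k (wtRanks P N (r ∷ rs) +P wtRanks P N (r ∷ rs ++ N′ ∷ []))
wtRanks-*P-a[b-a]^ P {N′} {k} refl r [] r<N′ [] = begin
  A^ e *P (aP *P ((bP -P aP) ^P k))                ≈⟨ *P-congˡ (A^ e) (*P-congˡ aP ([b-a]^P k)) ⟩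
  A^ e *P (aP *P signed k (A^ k))                  ≡⟨ cong (A^ e *P_) (*P-signedʳ k aP (A^ k)) ⟩
  A^ e *P signed k (aP *P A^ k)                    ≡⟨ *P-signedʳ k (A^ e) (aP *P A^ k) ⟩
  signed k (A^ e *P (aP *P A^ k))                  ≈⟨ signed-cong k (*P-congˡ (A^ e) (a*P-split (A^ k))) ⟩
  signed k (A^ e *P (A^ (suc k) +P (bP *P A^ k)))  ≈⟨ signed-cong k (*P-distribˡ-+P (A^ e) (A^ (suc k)) (bP *P A^ k)) ⟩
  signed k ((A^ e *P A^ (suc k)) +P (A^ e *P (bP *P A^ k)))
    ≡⟨ cong (λ s → signed k (s +P (A^ e *P (bP *P A^ k)))) (^P-+ (aP -P bP) e (suc k)) ⟩
  signed k (A^ (e ℕ.+ suc k) +P (A^ e *P (bP *P A^ k)))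
    ≡⟨ cong₂ (λ i j → signed k (A^ i +P (A^ e *P (bP *P A^ j))))
             (sym (∸-+-suc-∸1 r N′ k r<N′)) (sym (cong (_∸ 1) (ℕ.m+n∸m≡n N′ (suc k)))) ⟩
  signed k (A^ (N′ ℕ.+ suc k ∸ r ∸ 1) +P (A^ e *P (bP *P A^ (N′ ℕ.+ suc k ∸ N′ ∸ 1)))) ∎
  where
  open ≃-Reasoning
  A^ : ℕ → Poly
  A^ i = (aP -P bP) ^P i
  e = N′ ∸ r ∸ 1
wtRanks-*P-a[b-a]^ P {N′} {k} {N} N-eq r (s ∷ ss) r<N′ (s<N′ ∷ ss<N′) = begin
  (A^e *P (bP *P W)) *P X                   ≡⟨ *P-assoc A^e (bP *P W) X ⟩
  A^e *P ((bP *P W) *P X)                   ≡⟨ cong (A^e *P_) (*P-assoc bP W X) ⟩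
  A^e *P (bP *P (W *P X))                   ≈⟨ *P-congˡ A^e (*P-congˡ bP (wtRanks-*P-a[b-a]^ P N-eq s ss s<N′ ss<N′)) ⟩
  A^e *P (bP *P signed k (V +P V′))         ≡⟨ cong (A^e *P_) (*P-signedʳ k bP (V +P V′)) ⟩
  A^e *P signed k (bP *P (V +P V′))         ≡⟨ *P-signedʳ k A^e (bP *P (V +P V′)) ⟩
  signed k (A^e *P (bP *P (V +P V′)))       ≈⟨ signed-cong k (*P-congˡ A^e (*P-distribˡ-+P bP V V′)) ⟩
  signed k (A^e *P ((bP *P V) +P (bP *P V′))) ≈⟨ signed-cong k (*P-distribˡ-+P A^e (bP *P V) (bP *P V′)) ⟩
  signed k ((A^e *P (bP *P V)) +P (A^e *P (bP *P V′))) ∎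
  where
  open ≃-Reasoning
  A^e = (aP -P bP) ^P (s ∸ r ∸ 1)
  W = wtRanks P N′ (s ∷ ss)
  X = aP *P ((bP -P aP) ^P k)
  V = wtRanks P N (s ∷ ss)
  V′ = wtRanks P N (s ∷ ss ++ N′ ∷ [])

-- Finite sums

private variable
  A B : Set

∑ : List A → (A → ℤ) → ℤ
∑ xs f = foldr _+_ (+ 0) (map f xs)

∑-cong : ∀ (xs : List A) {f g : A → ℤ} → (∀ x → f x ≡ g x) → ∑ xs f ≡ ∑ xs g
∑-cong []       e = refl
∑-cong (x ∷ xs) e = cong₂ _+_ (e x) (∑-cong xs e)

∑-zero : ∀ (xs : List A) → ∑ xs (λ _ → + 0) ≡ + 0
∑-zero []       = refl
∑-zero (x ∷ xs) = trans (ℤ.+-identityˡ _) (∑-zero xs)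

∑-+ : ∀ (xs : List A) f g → ∑ xs (λ x → f x + g x) ≡ ∑ xs f + ∑ xs g
∑-+ []       f g = refl
∑-+ (x ∷ xs) f g = trans (cong (_+_ (f x + g x)) (∑-+ xs f g))
                         (interchange (f x) (g x) (∑ xs f) (∑ xs g))
  where
  interchange : ∀ a b c d → (a + b) + (c + d) ≡ (a + c) + (b + d)
  interchange = solve-∀

∑-*ˡ : ∀ (xs : List A) c f → ∑ xs (λ x → c * f x) ≡ c * ∑ xs f
∑-*ˡ []       c f = sym (ℤ.*-zeroʳ c)
∑-*ˡ (x ∷ xs) c f = trans (cong (_+_ (c * f x)) (∑-*ˡ xs c f)) (sym (ℤ.*-distribˡ-+ c (f x) (∑ xs f)))

∑-++ : ∀ (xs ys : List A) f → ∑ (xs ++ ys) f ≡ ∑ xs f + ∑ ys f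
∑-++ []       ys f = sym (ℤ.+-identityˡ (∑ ys f))
∑-++ (x ∷ xs) ys f = trans (cong (_+_ (f x)) (∑-++ xs ys f)) (sym (ℤ.+-assoc (f x) (∑ xs f) (∑ ys f)))

∑-swap : ∀ (xs : List A) (ys : List B) (f : A → B → ℤ) →
  ∑ xs (λ x → ∑ ys (f x)) ≡ ∑ ys (λ y → ∑ xs (λ x → f x y))
∑-swap []       ys f = sym (∑-zero ys)
∑-swap (x ∷ xs) ys f = trans (cong (_+_ (∑ ys (f x))) (∑-swap xs ys f))
                             (sym (∑-+ ys (f x) (λ y → ∑ xs (λ x → f x y))))

∑-map : ∀ (g : A → B) xs (f : B → ℤ) → ∑ (map g xs) f ≡ ∑ xs (λ x → f (g x))
∑-map g []       f = refl
∑-map g (x ∷ xs) f = cong (_+_ (f (g x))) (∑-map g xs f)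

∑-concatMap : ∀ (g : A → List B) xs (f : B → ℤ) → ∑ (concatMap g xs) f ≡ ∑ xs (λ x → ∑ (g x) f)
∑-concatMap g []       f = refl
∑-concatMap g (x ∷ xs) f = trans (∑-++ (g x) (concatMap g xs) f) (cong (_+_ (∑ (g x) f)) (∑-concatMap g xs f))

coeff-sumP : ∀ (g : A → Poly) xs w → coeff (sumP (map g xs)) w ≡ ∑ xs (λ x → coeff (g x) w)
coeff-sumP g []       w = refl
coeff-sumP g (x ∷ xs) w = trans (coeff-+P (g x) (sumP (map g xs)) w) (cong (_+_ (coeff (g x) w)) (coeff-sumP g xs w))

sumP-*P : ∀ (g : A → Poly) xs r → (sumP (map g xs) *P r) ≡ sumP (map (λ x → g x *P r) xs)
sumP-*P g []       r = refl
sumP-*P g (x ∷ xs) r = trans (*P-distribʳ-+P (g x) (sumP (map g xs)) r) (cong ((g x *P r) +P_) (sumP-*P g xs r))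

coeff-sumP-if : ∀ (b : A → Bool) (g : A → Poly) xs w →
  coeff (sumP (map (λ x → if b x then g x else 0P) xs)) w ≡ ∑ xs (λ x → if b x then coeff (g x) w else + 0)
coeff-sumP-if b g xs w = trans (coeff-sumP _ xs w) (∑-cong xs coeff-if)
  where
  coeff-if : ∀ x → coeff (if b x then g x else 0P) w ≡ (if b x then coeff (g x) w else + 0)
  coeff-if x with b x
  ... | true  = refl
  ... | false = refl

coeff-sumP-if-*P : ∀ (b : A → Bool) (g : A → Poly) xs r w →
  coeff (sumP (map (λ x → if b x then g x else 0P) xs) *P r) w ≡ ∑ xs (λ x → if b x then coeff (g x *P r) w else + 0)
coeff-sumP-if-*P b g xs r w = begin
  coeff (sumP (map (λ x → if b x then g x else 0P) xs) *P r) w          ≡⟨ cong (λ p → coeff p w) (sumP-*P _ xs r) ⟩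
  coeff (sumP (map (λ x → (if b x then g x else 0P) *P r) xs)) w        ≡⟨ cong (λ p → coeff p w) (cong sumP (List.map-cong if-*P xs)) ⟩
  coeff (sumP (map (λ x → if b x then g x *P r else 0P) xs)) w          ≡⟨ coeff-sumP-if b (λ x → g x *P r) xs w ⟩
  ∑ xs (λ x → if b x then coeff (g x *P r) w else + 0)                  ∎
  where
  open ≡-Reasoning
  if-*P : ∀ x → ((if b x then g x else 0P) *P r) ≡ (if b x then g x *P r else 0P)
  if-*P x with b x
  ... | true  = refl
  ... | false = refl

∑-if-swap : ∀ (xs : List A) (ys : List B) (f : A → ℤ) (g : B → ℤ) (b : B → Bool) (c : B → A → Bool) →
  ∑ xs (λ x → f x * ∑ ys (λ y → if b y ∧ c y x then g y else + 0))
    ≡ ∑ ys (λ y → if b y then g y * ∑ xs (λ x → if c y x then f x else + 0) else + 0)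
∑-if-swap xs ys f g b c = begin
  ∑ xs (λ x → f x * ∑ ys (λ y → if b y ∧ c y x then g y else + 0))      ≡⟨ ∑-cong xs (λ x → sym (∑-*ˡ ys (f x) _)) ⟩
  ∑ xs (λ x → ∑ ys (λ y → f x * (if b y ∧ c y x then g y else + 0)))    ≡⟨ ∑-swap xs ys _ ⟩
  ∑ ys (λ y → ∑ xs (λ x → f x * (if b y ∧ c y x then g y else + 0)))    ≡⟨ ∑-cong ys pull-out ⟩
  ∑ ys (λ y → if b y then g y * ∑ xs (λ x → if c y x then f x else + 0) else + 0) ∎
  where
  open ≡-Reasoning
  pull-out : ∀ y → ∑ xs (λ x → f x * (if b y ∧ c y x then g y else + 0))
                   ≡ (if b y then g y * ∑ xs (λ x → if c y x then f x else + 0) else + 0)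
  pull-out y with b y
  ... | false = trans (∑-cong xs (λ x → ℤ.*-zeroʳ (f x))) (∑-zero xs)
  ... | true  = trans (∑-cong xs commute) (∑-*ˡ xs (g y) _)
    where
    commute : ∀ x → f x * (if c y x then g y else + 0) ≡ g y * (if c y x then f x else + 0)
    commute x with c y x
    ... | true  = ℤ.*-comm (f x) (g y)
    ... | false = trans (ℤ.*-zeroʳ (f x)) (sym (ℤ.*-zeroʳ (g y)))

toggle : ∀ {k} → Fin k → Vec Bool k → Vec Bool k
toggle i S = S [ i ]≔ not (lookup S i)

∑-subsets-toggle : ∀ P {k} (i : Fin k) (f : Vec Bool k → ℤ) →
  ∑ (subsets P k) f ≡ ∑ (subsets P k) (f ∘ toggle i)
∑-subsets-toggle P {suc k} i f = begin
  ∑ (subsets P (suc k)) f                              ≡⟨ ∑-concatMap _ (subsets P k) f ⟩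
  ∑ (subsets P k) (λ v → f (true ∷ v) + (f (false ∷ v) + + 0))  ≡⟨ toggle-head-or-tail i ⟩
  ∑ (subsets P k) (λ v → f (toggle i (true ∷ v)) + (f (toggle i (false ∷ v)) + + 0))
    ≡⟨ ∑-concatMap _ (subsets P k) (f ∘ toggle i) ⟨
  ∑ (subsets P (suc k)) (f ∘ toggle i)                 ∎
  where
  open ≡-Reasoning
  swap : ∀ x y → x + (y + + 0) ≡ y + (x + + 0)
  swap = solve-∀
  toggle-head-or-tail : ∀ i →
    ∑ (subsets P k) (λ v → f (true ∷ v) + (f (false ∷ v) + + 0)) ≡
    ∑ (subsets P k) (λ v → f (toggle i (true ∷ v)) + (f (toggle i (false ∷ v)) + + 0))
  toggle-head-or-tail zero   = ∑-cong (subsets P k) λ v → swap (f (true ∷ v)) (f (false ∷ v))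
  toggle-head-or-tail (suc j) = ∑-subsets-toggle P j (λ v → f (true ∷ v) + (f (false ∷ v) + + 0))

T-ext : ∀ {b c} → (T b → T c) → (T c → T b) → b ≡ c
T-ext {false} {false} _ _ = refl
T-ext {false} {true}  _ g = ⊥-elim (g tt)
T-ext {true}  {false} f _ = ⊥-elim (f tt)
T-ext {true}  {true}  _ _ = refl

T-not-∨ : ∀ {a b} → T (not a ∨ b) ⇔ (T a → T b)
T-not-∨ {false} = mk⇔ (λ _ ()) (λ _ → tt)
T-not-∨ {true}  = mk⇔ (λ b _ → b) (λ f → f tt)

filterᵇ-cong : ∀ {p q : A → Bool} {xs} → All (λ x → p x ≡ q x) xs → filterᵇ p xs ≡ filterᵇ q xs
filterᵇ-cong [] = refl
filterᵇ-cong {p = p} {q} {x ∷ xs} (px≡qx ∷ eqs) with p x | q x | px≡qx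
... | true  | .true  | refl = cong (x ∷_) (filterᵇ-cong eqs)
... | false | .false | refl = filterᵇ-cong eqs

filterᵇ-upTo-+ : ∀ (p : ℕ → Bool) N d → (∀ {i} → N ℕ.≤ i → ¬ T (p i)) →
  filterᵇ p (upTo (N ℕ.+ d)) ≡ filterᵇ p (upTo N)
filterᵇ-upTo-+ p N zero    _      = cong (filterᵇ p ∘ upTo) (ℕ.+-identityʳ N)
filterᵇ-upTo-+ p N (suc d) ¬p≥N = begin
  filterᵇ p (upTo (N ℕ.+ suc d))                          ≡⟨ cong (filterᵇ p ∘ upTo) (ℕ.+-suc N d) ⟩
  filterᵇ p (upTo (suc (N ℕ.+ d)))                        ≡⟨ cong (filterᵇ p) (List.upTo-∷ʳ (N ℕ.+ d)) ⟨
  filterᵇ p (upTo (N ℕ.+ d) ∷ʳ (N ℕ.+ d))                 ≡⟨ List.filter-++ (T? ∘ p) (upTo (N ℕ.+ d)) _ ⟩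
  filterᵇ p (upTo (N ℕ.+ d)) ++ filterᵇ p (N ℕ.+ d ∷ [])  ≡⟨ cong (filterᵇ p (upTo (N ℕ.+ d)) ++_)
                                                               (List.filter-reject (T? ∘ p) (¬p≥N (ℕ.m≤m+n N d))) ⟩
  filterᵇ p (upTo (N ℕ.+ d)) ++ []                        ≡⟨ List.++-identityʳ _ ⟩
  filterᵇ p (upTo (N ℕ.+ d))                              ≡⟨ filterᵇ-upTo-+ p N d ¬p≥N ⟩
  filterᵇ p (upTo N)                                       ∎
  where open ≡-Reasoning

-- Graded posets

module GradedPoset {P : FinPoset} {n : ℕ} (G : IsGradedPoset P n) where
  open FinPoset P
  open IsGradedPoset G

  _≼_ _≺_ : Fin m → Fin m → Set
  _≼_ = _≤_ P
  _≺_ = _<_ P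

  ≼-trans : ∀ {x y z} → x ≼ y → y ≼ z → x ≼ z
  ≼-trans = trans≤ _ _ _

  ≺-isStrictPartialOrder : IsStrictPartialOrder _≡_ _≺_
  ≺-isStrictPartialOrder = record
    { isEquivalence = isEquivalence
    ; irrefl = λ { refl (_ , x≢x) → x≢x refl }
    ; trans = λ { {x} {y} (x≼y , x≢y) (y≼z , _) → ≼-trans x≼y y≼z , λ { refl → x≢y (antisym≤ x y x≼y y≼z) } }
    ; <-resp-≈ = (λ { refl x≺y → x≺y }) , (λ { refl x≺y → x≺y })
    }

  _≺?_ : ∀ x y → Dec (x ≺ y)
  x ≺? y = T? (leq x y) ×-dec ¬? (x Fin.≟ y)

  cover-below : ∀ {x y} → Acc _≺_ y → x ≺ y → Σ[ z ∈ Fin m ] (_⋖_ P x z × z ≼ y)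
  cover-below {x} {y} (acc rs) x≺y with Fin.any? (λ w → (x ≺? w) ×-dec (w ≺? y))
  ... | yes (w , x≺w , w≺y) =
    let z , x⋖z , z≼w = cover-below (rs w≺y) x≺w in z , x⋖z , ≼-trans z≼w (proj₁ w≺y)
  ... | no ∄w = y , (x≺y , λ w x≺w w≺y → ∄w (w , x≺w , w≺y)) , refl≤ y

  -- Climb a saturated chain from x to y; it terminates since ≺ is Noetherian on a finite set.
  rank-strictMono-acc : ∀ {x y} → Acc (λ a b → b ≺ a) x → x ≺ y → rank x ℕ.< rank y
  rank-strictMono-acc {x} {y} (acc rs) x≺y with cover-below (spo-wellFounded ≺-isStrictPartialOrder y) x≺y
  ... | z , x⋖z , z≼y with z Fin.≟ y
  ...   | yes refl = ℕ.≤-reflexive (sym (rank-cov x z x⋖z))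
  ...   | no  z≢y  = ℕ.<-trans (ℕ.≤-reflexive (sym (rank-cov x z x⋖z)))
                               (rank-strictMono-acc (rs (proj₁ x⋖z)) (z≼y , z≢y))

  rank-strictMono : ∀ {x y} → x ≺ y → rank x ℕ.< rank y
  rank-strictMono {x} = rank-strictMono-acc (spo-noetherian ≺-isStrictPartialOrder x)

  rank-mono : ∀ {x y} → x ≼ y → rank x ℕ.≤ rank y
  rank-mono {x} {y} x≼y with x Fin.≟ y
  ... | yes refl = ℕ.≤-refl
  ... | no  x≢y  = ℕ.<⇒≤ (rank-strictMono (x≼y , x≢y))

  bot≢above : ∀ {ν π} → bot ≺ ν → ν ≼ π → bot ≢ π
  bot≢above {ν} (bot≼ν , bot≢ν) ν≼π refl = bot≢ν (antisym≤ bot ν bot≼ν ν≼π)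

  rank≤n-acc : ∀ {x} → Acc (λ a b → b ≺ a) x → rank x ℕ.≤ n
  rank≤n-acc {x} (acc rs) with Fin.any? (x ≺?_)
  ... | yes (y , x≺y) = ℕ.<⇒≤ (ℕ.<-≤-trans (rank-strictMono x≺y) (rank≤n-acc (rs x≺y)))
  ... | no  ∄y        = ℕ.≤-reflexive (rank-max x maximal)
    where
    maximal : ∀ y → x ≼ y → y ≡ x
    maximal y x≼y with y Fin.≟ x
    ... | yes y≡x = y≡x
    ... | no  y≢x = ⊥-elim (∄y (y , x≼y , y≢x ∘ sym))

  rank≤n : ∀ x → rank x ℕ.≤ n
  rank≤n x = rank≤n-acc (spo-noetherian ≺-isStrictPartialOrder x)

  corank : Fin m → ℕ
  corank π = suc n ∸ rank π

  rank+corank : ∀ π → rank π ℕ.+ suc (corank π ∸ 1) ≡ suc n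
  rank+corank π = begin
    rank π ℕ.+ suc (corank π ∸ 1)        ≡⟨ cong (λ k → rank π ℕ.+ suc (k ∸ 1)) (ℕ.+-∸-assoc 1 (rank≤n π)) ⟩
    rank π ℕ.+ suc (n ∸ rank π)          ≡⟨ ℕ.+-suc (rank π) (n ∸ rank π) ⟩
    suc (rank π ℕ.+ (n ∸ rank π))        ≡⟨ cong suc (ℕ.m+[n∸m]≡n (rank≤n π)) ⟩
    suc n                                ∎
    where open ≡-Reasoning

sign-+ : ∀ P a b → sign P (a ℕ.+ b) ≡ sign P a * sign P b
sign-+ P zero    b = sym (ℤ.*-identityˡ (sign P b))
sign-+ P (suc a) b = trans (cong -_ (sign-+ P a b)) (ℤ.neg-distribˡ-* (sign P a) (sign P b))

sign-*-sign : ∀ P a → sign P a * sign P a ≡ + 1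
sign-*-sign P zero    = refl
sign-*-sign P (suc a) = trans (neg*neg (sign P a)) (sign-*-sign P a)
  where
  neg*neg : ∀ x → - x * - x ≡ x * x
  neg*neg = solve-∀

sign-corank : ∀ P {a b n} → a ℕ.≤ b → b ℕ.≤ n →
  sign P (suc n ∸ b ∸ 1) ≡ - sign P (suc n ∸ a) * sign P (b ∸ a)
sign-corank P {a} a≤b b≤n with ℕ.m≤n⇒∃[o]m+o≡n a≤b | ℕ.m≤n⇒∃[o]m+o≡n b≤n
... | e , refl | d , refl = begin
  sign P (suc (a ℕ.+ e ℕ.+ d) ∸ (a ℕ.+ e) ∸ 1)   ≡⟨ cong (sign P ∘ (_∸ 1)) (suc-+-∸ (a ℕ.+ e) d) ⟩
  sign P d                                      ≡⟨ ℤ.*-identityʳ (sign P d) ⟨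
  sign P d * + 1                                ≡⟨ cong (sign P d *_) (sign-*-sign P e) ⟨
  sign P d * (sign P e * sign P e)              ≡⟨ regroup (sign P e) (sign P d) ⟩
  - - (sign P e * sign P d) * sign P e          ≡⟨ cong (λ x → - - x * sign P e) (sign-+ P e d) ⟨
  - sign P (suc (e ℕ.+ d)) * sign P e           ≡⟨ cong₂ (λ i j → - sign P i * sign P j)
                                                         (sym (suc-+-∸ a (e ℕ.+ d))) (sym (ℕ.m+n∸m≡n a e)) ⟩
  - sign P (suc (a ℕ.+ (e ℕ.+ d)) ∸ a) * sign P (a ℕ.+ e ∸ a)
    ≡⟨ cong (λ i → - sign P (suc i ∸ a) * sign P (a ℕ.+ e ∸ a)) (ℕ.+-assoc a e d) ⟨
  - sign P (suc (a ℕ.+ e ℕ.+ d) ∸ a) * sign P (a ℕ.+ e ∸ a) ∎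
  where
  open ≡-Reasoning
  suc-+-∸ : ∀ x y → suc (x ℕ.+ y) ∸ x ≡ suc y
  suc-+-∸ x y = trans (cong (_∸ x) (sym (ℕ.+-suc x y))) (ℕ.m+n∸m≡n x (suc y))
  regroup : ∀ x y → y * (x * x) ≡ - - (x * y) * x
  regroup = solve-∀

-- Chains

module Chains (P : FinPoset) where
  open FinPoset P

  T-allF : ∀ f → T (allF P f) ⇔ (∀ x → T (f x))
  T-allF f = mk⇔ (λ h x → All.lookup (all⁺ f (allFin m) h) (∈-allFin x))
                 (λ h → all⁻ f {xs = allFin m} (All.tabulate λ {x} _ → h x))

  _∈ₛ_ : Fin m → Vec Bool m → Set
  x ∈ₛ S = T (lookup S x)

  record IsChainIn (Q : Fin m → Bool) (S : Vec Bool m) : Set where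
    field
      bot-∈  : bot ∈ₛ S
      ⊆Q     : ∀ {x} → x ∈ₛ S → T (Q x)
      linear : ∀ {x y} → x ∈ₛ S → y ∈ₛ S → T (leq x y ∨ leq y x)

  T-isChainIn : ∀ Q S → T (isChainIn P Q S) ⇔ IsChainIn Q S
  T-isChainIn Q S = mk⇔ sound complete
    where
    inQ : Fin m → Bool
    inQ x = not (lookup S x) ∨ Q x
    comparable : Fin m → Fin m → Bool
    comparable x y = not (lookup S x ∧ lookup S y) ∨ (leq x y ∨ leq y x)
    sound : T (isChainIn P Q S) → IsChainIn Q S
    sound h = record
      { bot-∈  = bot-∈
      ; ⊆Q     = λ {x} → to T-not-∨ (to (T-allF inQ) ⊆Q x)
      ; linear = λ {x} {y} x∈S y∈S →
          to T-not-∨ (to (T-allF (comparable x)) (to (T-allF (λ x → allF P (comparable x))) linear x) y)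
             (from T-∧ (x∈S , y∈S))
      }
      where
      bot-∈ = proj₁ (to (T-∧ {lookup S bot}) h)
      ⊆Q∧linear = proj₂ (to (T-∧ {lookup S bot}) h)
      ⊆Q = proj₁ (to (T-∧ {allF P inQ}) ⊆Q∧linear)
      linear = proj₂ (to (T-∧ {allF P inQ}) ⊆Q∧linear)
    complete : IsChainIn Q S → T (isChainIn P Q S)
    complete c = from (T-∧ {lookup S bot}) (bot-∈ , from (T-∧ {allF P inQ})
      ( from (T-allF inQ) (λ x → from T-not-∨ ⊆Q)
      , from (T-allF (λ x → allF P (comparable x))) λ x → from (T-allF (comparable x)) λ y →
          from T-not-∨ λ xy∈S → let x∈S , y∈S = to (T-∧ {lookup S x}) xy∈S in linear x∈S y∈S ))
      where open IsChainIn c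

  isChainIn-≡ : ∀ {Q Q′ S S′} → (IsChainIn Q S → IsChainIn Q′ S′) → (IsChainIn Q′ S′ → IsChainIn Q S) →
    isChainIn P Q S ≡ isChainIn P Q′ S′
  isChainIn-≡ {Q} {Q′} {S} {S′} f g =
    T-ext (from (T-isChainIn Q′ S′) ∘ f ∘ to (T-isChainIn Q S)) (from (T-isChainIn Q S) ∘ g ∘ to (T-isChainIn Q′ S′))

  IsChainIn-mono : ∀ {Q Q′ S} → (∀ {x} → x ∈ₛ S → T (Q x) → T (Q′ x)) → IsChainIn Q S → IsChainIn Q′ S
  IsChainIn-mono Q⇒Q′ c = record { bot-∈ = bot-∈ ; ⊆Q = λ x∈S → Q⇒Q′ x∈S (⊆Q x∈S) ; linear = linear }
    where open IsChainIn c

module IntervalChains {P : FinPoset} {n : ℕ} (G : IsGradedPoset P n) where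
  open FinPoset P
  open IsGradedPoset G
  open GradedPoset G
  open Chains P
  open IsChainIn

  closedBelow : Fin m → Fin m → Bool
  closedBelow π x = leq x π

  T-below : ∀ {π x} → T (below P π x) ⇔ x ≺ π
  T-below {π} {x} with x Fin.≟ π
  ... | yes refl = mk⇔ (λ π≼π∧false → ⊥-elim (to (T-∧ {leq π π}) π≼π∧false .proj₂))
                       (λ (_ , π≢π) → ⊥-elim (π≢π refl))
  ... | no  x≢π  = mk⇔ (λ x≼π → to (T-∧ {leq x π}) x≼π .proj₁ , x≢π)
                       (λ (x≼π , _) → from (T-∧ {leq x π}) (x≼π , tt))

  chain-max : ∀ {Q S} → IsChainIn Q S → Σ[ τ ∈ Fin m ] (τ ∈ₛ S × (∀ {x} → x ∈ₛ S → x ≼ τ))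
  chain-max {S = S} c = let τ , τ∈S , ≼τ = max-of (allFin m) in τ , τ∈S , λ {x} → ≼τ (∈-allFin x)
    where
    max-of : ∀ xs → Σ[ τ ∈ Fin m ] (τ ∈ₛ S × (∀ {x} → x ∈ xs → x ∈ₛ S → x ≼ τ))
    max-of [] = bot , bot-∈ c , λ ()
    max-of (y ∷ ys) with max-of ys | T? (lookup S y)
    ... | τ , τ∈S , ≼τ | no y∉S = τ , τ∈S , λ { (here refl) y∈S → ⊥-elim (y∉S y∈S) ; (there x∈ys) → ≼τ x∈ys }
    ... | τ , τ∈S , ≼τ | yes y∈S with T? (leq y τ)
    ...   | yes y≼τ = τ , τ∈S , λ { (here refl) _ → y≼τ ; (there x∈ys) → ≼τ x∈ys }
    ...   | no  y⋠τ = y , y∈S , λ { (here refl) _ → refl≤ y ; (there x∈ys) x∈S → ≼-trans (≼τ x∈ys x∈S) τ≼y }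
      where
      τ≼y : τ ≼ y
      τ≼y = [ (λ y≼τ → ⊥-elim (y⋠τ y≼τ)) , (λ τ≼y → τ≼y) ]′ (to (T-∨ {leq y τ}) (linear c y∈S τ∈S))

  isChainIn-closedBelow-max : ∀ {Q S τ} → IsChainIn Q S → τ ∈ₛ S → (∀ {x} → x ∈ₛ S → x ≼ τ) →
    ∀ π → isChainIn P (closedBelow π) S ≡ leq τ π
  isChainIn-closedBelow-max {S = S} c τ∈S ≼τ π =
    T-ext (λ h → ⊆Q (to (T-isChainIn (closedBelow π) S) h) τ∈S)
        (λ τ≼π → from (T-isChainIn (closedBelow π) S) (record { bot-∈ = bot-∈ c ; ⊆Q = λ x∈S → ≼-trans (≼τ x∈S) τ≼π ; linear = linear c }))

  isChainIn-below-∋ : ∀ {π S} → π ∈ₛ S → isChainIn P (below P π) S ≡ false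
  isChainIn-below-∋ {π} {S} π∈S =
    T-ext (λ h → proj₂ (to T-below (⊆Q (to (T-isChainIn (below P π) S) h) π∈S)) refl) λ ()

  isChainIn-below-∌ : ∀ {π S} → ¬ π ∈ₛ S → isChainIn P (below P π) S ≡ isChainIn P (closedBelow π) S
  isChainIn-below-∌ {π} {S} π∉S = isChainIn-≡ weaken strengthen
    where
    weaken : IsChainIn (below P π) S → IsChainIn (closedBelow π) S
    weaken = IsChainIn-mono λ _ x≺π → proj₁ (to T-below x≺π)
    strengthen : IsChainIn (closedBelow π) S → IsChainIn (below P π) S
    strengthen = IsChainIn-mono λ {x} x∈S x≼π → from T-below (x≼π , λ { refl → π∉S x∈S })

  isChainIn-below-remove : ∀ {π S} → bot ≢ π → π ∈ₛ S →
    isChainIn P (below P π) (S [ π ]≔ false) ≡ isChainIn P (closedBelow π) S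
  isChainIn-below-remove {π} {S} bot≢π π∈S = isChainIn-≡ add remove
    where
    S⁻ = S [ π ]≔ false
    π∉S⁻ : ¬ π ∈ₛ S⁻
    π∉S⁻ rewrite Vec.lookup∘update π S false = λ ()
    ≢π : ∀ {x} → x ∈ₛ S⁻ → x ≢ π
    ≢π x∈S⁻ refl = π∉S⁻ x∈S⁻
    ∈S⁻ : ∀ {x} → x ≢ π → x ∈ₛ S → x ∈ₛ S⁻
    ∈S⁻ x≢π = subst T (sym (Vec.lookup∘update′ x≢π S false))
    ∈S : ∀ {x} → x ∈ₛ S⁻ → x ∈ₛ S
    ∈S x∈S⁻ = subst T (Vec.lookup∘update′ (≢π x∈S⁻) S false) x∈S⁻
    add : IsChainIn (below P π) S⁻ → IsChainIn (closedBelow π) S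
    add c = record
      { bot-∈ = ∈S (bot-∈ c)
      ; ⊆Q = ≼π
      ; linear = linear′
      }
      where
      ≼π : ∀ {x} → x ∈ₛ S → T (leq x π)
      ≼π {x} x∈S with x Fin.≟ π
      ... | yes refl = refl≤ π
      ... | no  x≢π  = proj₁ (to T-below (⊆Q c (∈S⁻ x≢π x∈S)))
      linear′ : ∀ {x y} → x ∈ₛ S → y ∈ₛ S → T (leq x y ∨ leq y x)
      linear′ {x} {y} x∈S y∈S with x Fin.≟ π | y Fin.≟ π
      ... | yes refl | _        = from (T-∨ {leq π y}) (inj₂ (≼π y∈S))
      ... | no  _    | yes refl = from (T-∨ {leq x π}) (inj₁ (≼π x∈S))
      ... | no  x≢π  | no  y≢π  = linear c (∈S⁻ x≢π x∈S) (∈S⁻ y≢π y∈S)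
    remove : IsChainIn (closedBelow π) S → IsChainIn (below P π) S⁻
    remove c = record
      { bot-∈ = ∈S⁻ bot≢π (bot-∈ c)
      ; ⊆Q = λ x∈S⁻ → from T-below (⊆Q c (∈S x∈S⁻) , ≢π x∈S⁻)
      ; linear = λ x∈S⁻ y∈S⁻ → linear c (∈S x∈S⁻) (∈S y∈S⁻)
      }

  -- Toggling π pairs each chain of [0̂, π) not containing π with the chain obtained by adding π;
  -- together they are exactly the chains of [0̂, π].
  ∑-chains-below-add-top : ∀ {π} (F : Vec Bool m → ℤ) → bot ≢ π →
    ∑ (subsets P m) (λ S → if isChainIn P (below P π) S then F S + F (S [ π ]≔ true) else + 0)
      ≡ ∑ (subsets P m) (λ S → if isChainIn P (closedBelow π) S then F S else + 0)
  ∑-chains-below-add-top {π} F bot≢π = begin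
    ∑ Ss (λ S → if C₀ S then F S + F (S [ π ]≔ true) else + 0)   ≡⟨ ∑-cong Ss split ⟩
    ∑ Ss (λ S → f S + g S)                                       ≡⟨ ∑-+ Ss f g ⟩
    ∑ Ss f + ∑ Ss g                                              ≡⟨ cong (_+_ (∑ Ss f)) (∑-subsets-toggle P π g) ⟩
    ∑ Ss f + ∑ Ss (g ∘ toggle π)                                 ≡⟨ ∑-+ Ss f (g ∘ toggle π) ⟨
    ∑ Ss (λ S → f S + g (toggle π S))                            ≡⟨ ∑-cong Ss pair ⟩
    ∑ Ss (λ S → if isChainIn P (closedBelow π) S then F S else + 0) ∎
    where
    open ≡-Reasoning
    Ss = subsets P m
    C₀ = isChainIn P (below P π)
    f g : Vec Bool m → ℤ
    f S = if C₀ S then F S else + 0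
    g S = if C₀ S then F (S [ π ]≔ true) else + 0
    split : ∀ S → (if C₀ S then F S + F (S [ π ]≔ true) else + 0) ≡ f S + g S
    split S with C₀ S
    ... | true  = refl
    ... | false = refl
    pair : ∀ S → f S + g (toggle π S) ≡ (if isChainIn P (closedBelow π) S then F S else + 0)
    pair S with lookup S π in e
    ... | true
      rewrite isChainIn-below-∋ {π} {S} (subst T (sym e) tt)
            | isChainIn-below-remove {π} {S} bot≢π (subst T (sym e) tt)
            | Vec.[]≔-idempotent {x = false} {y = true} S π
            | sym e | Vec.[]≔-lookup S π
      = ℤ.+-identityˡ _
    ... | false
      rewrite isChainIn-below-∌ {π} {S} (subst (λ b → ¬ T b) (sym e) λ ())
            | isChainIn-below-∋ {π} {S [ π ]≔ true} (subst T (sym (Vec.lookup∘update π S true)) tt)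
      = ℤ.+-identityʳ _

module ChainRanks {P : FinPoset} {n : ℕ} (G : IsGradedPoset P n) where
  open FinPoset P
  open IsGradedPoset G
  open GradedPoset G
  open Chains P
  open IntervalChains G

  -- chainRanks P N S is definitionally filterᵇ (rankOccurs S) (upTo N).
  rankOccurs : Vec Bool m → ℕ → Bool
  rankOccurs S i = any (λ x → lookup S x ∧ does (rank x ℕ.≟ i)) (allFin m)

  T-rankOccurs : ∀ S i → T (rankOccurs S i) ⇔ (Σ[ x ∈ Fin m ] (x ∈ₛ S × rank x ≡ i))
  T-rankOccurs S i = mk⇔ occurs witness
    where
    occurs : T (rankOccurs S i) → Σ[ x ∈ Fin m ] (x ∈ₛ S × rank x ≡ i)
    occurs h with Any.satisfied (any⁻ _ (allFin m) h)
    ... | x , x∈S∧rx≡i = let x∈S , rx≡i = to (T-∧ {lookup S x}) x∈S∧rx≡i in x , x∈S , ℕ.≡ᵇ⇒≡ (rank x) i rx≡i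
    witness : Σ[ x ∈ Fin m ] (x ∈ₛ S × rank x ≡ i) → T (rankOccurs S i)
    witness (x , x∈S , rx≡i) = any⁺ _ (lose (∈-allFin x) (from (T-∧ {lookup S x}) (x∈S , ℕ.≡⇒≡ᵇ (rank x) i rx≡i)))

  ¬rankOccurs-≥ : ∀ {S N} → (∀ {x} → x ∈ₛ S → rank x ℕ.< N) → ∀ {i} → N ℕ.≤ i → ¬ T (rankOccurs S i)
  ¬rankOccurs-≥ {S} below-N {i} N≤i h with to (T-rankOccurs S i) h
  ... | x , x∈S , refl = ℕ.<⇒≱ (below-N x∈S) N≤i

  module ChainBelow {π S} (c : IsChainIn (below P π) S) where
    open IsChainIn c

    rank<rank-top : ∀ {x} → x ∈ₛ S → rank x ℕ.< rank π
    rank<rank-top x∈S = rank-strictMono (to T-below (⊆Q x∈S))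

    top∉ : ¬ π ∈ₛ S
    top∉ π∈S = ℕ.<-irrefl refl (rank<rank-top π∈S)

    chainRanks-below : chainRanks P (suc n) S ≡ chainRanks P (rank π) S
    chainRanks-below = trans
      (cong (filterᵇ (rankOccurs S) ∘ upTo) (sym (ℕ.m+[n∸m]≡n (ℕ.m≤n⇒m≤1+n (rank≤n π)))))
      (filterᵇ-upTo-+ (rankOccurs S) (rank π) _ (¬rankOccurs-≥ {S} rank<rank-top))

    S⁺ = S [ π ]≔ true

    ∈S⁺ : ∀ {x} → x ∈ₛ S⁺ → x ∈ₛ S ⊎ x ≡ π
    ∈S⁺ {x} x∈S⁺ with x Fin.≟ π
    ... | yes x≡π = inj₂ x≡π
    ... | no  x≢π = inj₁ (subst T (Vec.lookup∘update′ x≢π S true) x∈S⁺)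

    π∈S⁺ : π ∈ₛ S⁺
    π∈S⁺ = subst T (sym (Vec.lookup∘update π S true)) tt

    S⊆S⁺ : ∀ {x} → x ∈ₛ S → x ∈ₛ S⁺
    S⊆S⁺ {x} x∈S = subst T (sym (Vec.lookup∘update′ (λ { refl → top∉ x∈S }) S true)) x∈S

    rankOccurs-S⁺ : ∀ {i} → i ℕ.< rank π → rankOccurs S⁺ i ≡ rankOccurs S i
    rankOccurs-S⁺ {i} i<rπ = T-ext remove-top add-top
      where
      remove-top : T (rankOccurs S⁺ i) → T (rankOccurs S i)
      remove-top h with to (T-rankOccurs S⁺ i) h
      ... | x , x∈S⁺ , rx≡i with ∈S⁺ x∈S⁺
      ...   | inj₁ x∈S = from (T-rankOccurs S i) (x , x∈S , rx≡i)
      ...   | inj₂ refl = ⊥-elim (ℕ.<-irrefl (sym rx≡i) i<rπ)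
      add-top : T (rankOccurs S i) → T (rankOccurs S⁺ i)
      add-top h = let x , x∈S , rx≡i = to (T-rankOccurs S i) h in from (T-rankOccurs S⁺ i) (x , S⊆S⁺ x∈S , rx≡i)

    chainRanks-add-top : chainRanks P (suc n) S⁺ ≡ chainRanks P (rank π) S ++ rank π ∷ []
    chainRanks-add-top = begin
      filterᵇ occ⁺ (upTo (suc n))                         ≡⟨ cong (filterᵇ occ⁺ ∘ upTo ∘ suc) (sym (ℕ.m+[n∸m]≡n (rank≤n π))) ⟩
      filterᵇ occ⁺ (upTo (suc (rank π) ℕ.+ (n ∸ rank π))) ≡⟨ filterᵇ-upTo-+ occ⁺ (suc (rank π)) _ (¬rankOccurs-≥ {S⁺} ≤rank-top) ⟩
      filterᵇ occ⁺ (upTo (suc (rank π)))                  ≡⟨ cong (filterᵇ occ⁺) (List.upTo-∷ʳ (rank π)) ⟨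
      filterᵇ occ⁺ (upTo (rank π) ∷ʳ rank π)              ≡⟨ List.filter-++ (T? ∘ occ⁺) (upTo (rank π)) _ ⟩
      filterᵇ occ⁺ (upTo (rank π)) ++ filterᵇ occ⁺ (rank π ∷ [])
        ≡⟨ cong₂ _++_ (filterᵇ-cong (All.map rankOccurs-S⁺ (all-upTo (rank π))))
                      (List.filter-accept (T? ∘ occ⁺) (from (T-rankOccurs S⁺ (rank π)) (π , π∈S⁺ , refl))) ⟩
      filterᵇ (rankOccurs S) (upTo (rank π)) ++ rank π ∷ [] ∎
      where
      open ≡-Reasoning
      occ⁺ = rankOccurs S⁺
      ≤rank-top : ∀ {x} → x ∈ₛ S⁺ → rank x ℕ.< suc (rank π)
      ≤rank-top x∈S⁺ with ∈S⁺ x∈S⁺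
      ... | inj₁ x∈S = ℕ.m≤n⇒m≤1+n (rank<rank-top x∈S)
      ... | inj₂ refl = ℕ.≤-refl

    chainRanks-from-bot : bot ≢ π →
      Σ[ rs ∈ List ℕ ] (chainRanks P (rank π) S ≡ 0 ∷ rs × All (ℕ._< rank π) rs)
    chainRanks-from-bot bot≢π with rank π | rank<rank-top bot-∈
    ... | suc j | _ = _ , starts-0 , All.tail (subst (All (ℕ._< suc j)) starts-0 (filter⁺ (T? ∘ rankOccurs S) (all-upTo (suc j))))
      where
      starts-0 : filterᵇ (rankOccurs S) (upTo (suc j)) ≡ 0 ∷ _
      starts-0 = List.filter-accept (T? ∘ rankOccurs S) (from (T-rankOccurs S 0) (bot , bot-∈ , rank-bot))

-- The Eulerian relation and the proposition

module EulerianLattice {P : FinPoset} {n : ℕ} (G : IsGradedPoset P n) (L : IsLattice P) (E : IsEulerian P n) where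
  open FinPoset P
  open IsGradedPoset G
  open IsLattice L
  open GradedPoset G
  open Chains P
  open IntervalChains G

  ∑-above-sign : ∀ μ → ∑ (allFin m) (λ π → if leq μ π then sign P (corank π ∸ 1) else + 0) ≡ + 1
  ∑-above-sign μ = begin
    ∑ (allFin m) (λ π → if leq μ π then sign P (corank π ∸ 1) else + 0) ≡⟨ ∑-cong (allFin m) factor ⟩
    ∑ (allFin m) (λ π → - s * h π)                                       ≡⟨ ∑-*ˡ (allFin m) (- s) h ⟩
    - s * ∑ (allFin m) h                                                 ≡⟨ cong (_*_ (- s)) ∑h≡-s ⟩
    - s * - s                                                            ≡⟨ sign-*-sign P (suc (corank μ)) ⟩
    + 1                                                                  ∎
    where
    open ≡-Reasoning
    s = sign P (corank μ)
    h : Fin m → ℤ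
    h π = if leq μ π ∧ true then sign P (rank π ∸ rank μ) else + 0
    -- the Euler relation on [μ, 1̂], with the term σ = 1̂ split off
    euler : s + ∑ (allFin m) h ≡ + 0
    euler = trans (cong (_+_ s) (sym (∑-map el (allFin m) _))) (E (el μ) top (tt , λ ()))
    ∑h≡-s : ∑ (allFin m) h ≡ - s
    ∑h≡-s = begin
      ∑ (allFin m) h                  ≡⟨ ℤ.+-identityˡ _ ⟨
      + 0 + ∑ (allFin m) h            ≡⟨ cong (_+ ∑ (allFin m) h) (ℤ.+-inverseˡ s) ⟨
      - s + s + ∑ (allFin m) h        ≡⟨ ℤ.+-assoc (- s) s _ ⟩
      - s + (s + ∑ (allFin m) h)      ≡⟨ cong (_+_ (- s)) euler ⟩
      - s + + 0                       ≡⟨ ℤ.+-identityʳ (- s) ⟩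
      - s                             ∎
    factor : ∀ π → (if leq μ π then sign P (corank π ∸ 1) else + 0) ≡ - s * h π
    factor π with leq μ π in μ≤π
    ... | true  = sign-corank P (rank-mono (subst T (sym μ≤π) tt)) (rank≤n π)
    ... | false = sym (ℤ.*-zeroʳ (- s))

  ≤E-trans : ∀ x y z → T (leqE P x y) → T (leqE P y z) → T (leqE P x z)
  ≤E-trans (el x) y        top    _   _   = tt
  ≤E-trans top    y        top    _   _   = tt
  ≤E-trans x      top      (el z) _   ()
  ≤E-trans top    (el y)   (el z) ()  _
  ≤E-trans (el x) (el y)   (el z) x≤y y≤z = trans≤ x y z x≤y y≤z

  join-≤E : ∀ x y z → leqE P (join x y) z ≡ (leqE P x z ∧ leqE P y z)
  join-≤E x y z = T-ext
    (λ x∨y≤z → from (T-∧ {leqE P x z})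
      (≤E-trans x (join x y) z (join-ubˡ x y) x∨y≤z , ≤E-trans y (join x y) z (join-ubʳ x y) x∨y≤z))
    (λ x≤z∧y≤z → let x≤z , y≤z = to (T-∧ {leqE P x z}) x≤z∧y≤z in join-lub x y z x≤z y≤z)

  -- Writing τ for the top of the chain S, the π counted are those above τ ∨ ν,
  -- and S ⊆ Λ_ν exactly when τ ∨ ν < 1̂.
  ∑-sign-above-chain : ∀ ν S →
    ∑ (allFin m) (λ π → if leq ν π ∧ isChainIn P (closedBelow π) S then sign P (corank π ∸ 1) else + 0)
      ≡ (if isChainIn P (Λ_ P L ν) S then + 1 else + 0)
  ∑-sign-above-chain ν S with T? (isChainIn P (λ _ → true) S)
  ... | no ¬chain = begin
    ∑ (allFin m) (λ π → if leq ν π ∧ isChainIn P (closedBelow π) S then sign P (corank π ∸ 1) else + 0)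
      ≡⟨ ∑-cong (allFin m) vanish ⟩
    ∑ (allFin m) (λ _ → + 0)                             ≡⟨ ∑-zero (allFin m) ⟩
    + 0                                                  ≡⟨ cong (λ b → if b then + 1 else + 0) (not-chain (Λ_ P L ν)) ⟨
    (if isChainIn P (Λ_ P L ν) S then + 1 else + 0)     ∎
    where
    not-chain : ∀ Q → isChainIn P Q S ≡ false
    not-chain Q = T-ext (λ h → ¬chain (from (T-isChainIn _ S) (IsChainIn-mono (λ _ _ → tt) (to (T-isChainIn Q S) h))))
                      λ ()
    vanish : ∀ π → (if leq ν π ∧ isChainIn P (closedBelow π) S then sign P (corank π ∸ 1) else + 0) ≡ + 0
    vanish π rewrite not-chain (closedBelow π) | ∧-zeroʳ (leq ν π) = refl
    open ≡-Reasoning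
  ... | yes chain with chain-max (to (T-isChainIn _ S) chain)
  ...   | τ , τ∈S , ≼τ = trans (∑-cong (allFin m) λ π → cong (λ b → if b then _ else + 0) (above-join π))
                               (by-join (join (el τ) (el ν)) refl)
    where
    c = to (T-isChainIn _ S) chain
    above-join : ∀ π → (leq ν π ∧ isChainIn P (closedBelow π) S) ≡ leqE P (join (el τ) (el ν)) (el π)
    above-join π = begin
      leq ν π ∧ isChainIn P (closedBelow π) S   ≡⟨ cong (leq ν π ∧_) (isChainIn-closedBelow-max c τ∈S ≼τ π) ⟩
      leq ν π ∧ leq τ π                         ≡⟨ ∧-comm (leq ν π) (leq τ π) ⟩
      leq τ π ∧ leq ν π                         ≡⟨ join-≤E (el τ) (el ν) (el π) ⟨
      leqE P (join (el τ) (el ν)) (el π)        ∎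
      where open ≡-Reasoning
    by-join : ∀ J → join (el τ) (el ν) ≡ J →
      ∑ (allFin m) (λ π → if leqE P J (el π) then sign P (corank π ∸ 1) else + 0)
        ≡ (if isChainIn P (Λ_ P L ν) S then + 1 else + 0)
    by-join top τ∨ν≡1̂ = trans (∑-zero (allFin m)) (cong (λ b → if b then + 1 else + 0) (sym outside))
      where
      outside : isChainIn P (Λ_ P L ν) S ≡ false
      outside = T-ext (λ h → subst (T ∘ not ∘ isTop P) τ∨ν≡1̂ (IsChainIn.⊆Q (to (T-isChainIn _ S) h) τ∈S)) λ ()
    by-join (el μ) τ∨ν≡μ = trans (∑-above-sign μ) (cong (λ b → if b then + 1 else + 0) (sym inside))
      where
      τ≼μ : τ ≼ μ
      τ≼μ = subst (T ∘ leqE P (el τ)) τ∨ν≡μ (join-ubˡ (el τ) (el ν))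
      ν≼μ : ν ≼ μ
      ν≼μ = subst (T ∘ leqE P (el ν)) τ∨ν≡μ (join-ubʳ (el τ) (el ν))
      in-Λν : ∀ {x} → x ∈ₛ S → T (Λ_ P L ν x)
      in-Λν {x} x∈S with join (el x) (el ν) | join-lub (el x) (el ν) (el μ) (≼-trans (≼τ x∈S) τ≼μ) ν≼μ
      ... | el _ | _  = tt
      ... | top  | ()
      inside : isChainIn P (Λ_ P L ν) S ≡ true
      inside = T-ext (λ _ → tt) λ _ → from (T-isChainIn _ S)
        (record { bot-∈ = IsChainIn.bot-∈ c ; ⊆Q = in-Λν ; linear = IsChainIn.linear c })

  ∑-chains-Λ : ∀ ν (F : Vec Bool m → ℤ) →
    ∑ (subsets P m) (λ S → if isChainIn P (Λ_ P L ν) S then F S else + 0)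
      ≡ ∑ (allFin m) (λ π → if leq ν π
          then sign P (corank π ∸ 1) * ∑ (subsets P m) (λ S → if isChainIn P (closedBelow π) S then F S else + 0)
          else + 0)
  ∑-chains-Λ ν F = trans (sym (∑-cong (subsets P m) weigh))
    (∑-if-swap (subsets P m) (allFin m) F (λ π → sign P (corank π ∸ 1)) (leq ν) (λ π → isChainIn P (closedBelow π)))
    where
    weigh : ∀ S → F S * ∑ (allFin m) (λ π → if leq ν π ∧ isChainIn P (closedBelow π) S then sign P (corank π ∸ 1) else + 0)
                  ≡ (if isChainIn P (Λ_ P L ν) S then F S else + 0)
    weigh S rewrite ∑-sign-above-chain ν S with isChainIn P (Λ_ P L ν) S
    ... | true  = ℤ.*-identityʳ (F S)
    ... | false = ℤ.*-zeroʳ (F S)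

module LowerIntervals {P : FinPoset} {n : ℕ} (G : IsGradedPoset P n) where
  open FinPoset P
  open GradedPoset G
  open Chains P
  open IntervalChains G
  open ChainRanks G

  chainWeight : Vec Bool m → Poly
  chainWeight S = wtRanks P (suc n) (chainRanks P (suc n) S)

  a[b-a]^ : Fin m → Poly
  a[b-a]^ π = aP *P ((bP -P aP) ^P (corank π ∸ 1))

  coeff-wt-below-*P : ∀ {π S} → bot ≢ π → IsChainIn (below P π) S → ∀ w →
    coeff (wtRanks P (rank π) (chainRanks P (rank π) S) *P a[b-a]^ π) w
      ≡ sign P (corank π ∸ 1) * (coeff (chainWeight S) w + coeff (chainWeight (S [ π ]≔ true)) w)
  coeff-wt-below-*P {π} {S} bot≢π c w with ChainBelow.chainRanks-from-bot c bot≢π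
  ... | rs , ranks≡0∷rs , rs<rπ = begin
    coeff (wtRanks P (rank π) (chainRanks P (rank π) S) *P a[b-a]^ π) w
      ≡⟨ cong (λ ranks → coeff (wtRanks P (rank π) ranks *P a[b-a]^ π) w) ranks≡0∷rs ⟩
    coeff (wtRanks P (rank π) (0 ∷ rs) *P a[b-a]^ π) w
      ≡⟨ coeff-≡ (wtRanks-*P-a[b-a]^ P (rank+corank π) 0 rs 0<rπ rs<rπ) w ⟩
    coeff (signed k (wtRanks P (suc n) (0 ∷ rs) +P wtRanks P (suc n) (0 ∷ rs ++ rank π ∷ []))) w
      ≡⟨ coeff-signed P k _ w ⟩
    sign P k * coeff (wtRanks P (suc n) (0 ∷ rs) +P wtRanks P (suc n) (0 ∷ rs ++ rank π ∷ [])) w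
      ≡⟨ cong (sign P k *_) (coeff-+P (wtRanks P (suc n) (0 ∷ rs)) _ w) ⟩
    sign P k * (coeff (wtRanks P (suc n) (0 ∷ rs)) w + coeff (wtRanks P (suc n) (0 ∷ rs ++ rank π ∷ [])) w)
      ≡⟨ cong₂ (λ ranks ranks⁺ → sign P k * (coeff (wtRanks P (suc n) ranks) w + coeff (wtRanks P (suc n) ranks⁺) w))
               (sym (trans (ChainBelow.chainRanks-below c) ranks≡0∷rs))
               (sym (trans (ChainBelow.chainRanks-add-top c) (cong (_++ rank π ∷ []) ranks≡0∷rs))) ⟩
    sign P k * (coeff (chainWeight S) w + coeff (chainWeight (S [ π ]≔ true)) w) ∎
    where
    open ≡-Reasoning
    k = corank π ∸ 1
    0<rπ : 0 ℕ.< rank π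
    0<rπ = subst (ℕ._< rank π) (IsGradedPoset.rank-bot G) (rank-strictMono (IsGradedPoset.bot-min G π , bot≢π))

  coeff-Ψ-below-*P : ∀ {π} → bot ≢ π → ∀ w →
    coeff (Ψ P (below P π) (rank π) *P a[b-a]^ π) w
      ≡ sign P (corank π ∸ 1) * ∑ (subsets P m) (λ S → if isChainIn P (closedBelow π) S then coeff (chainWeight S) w else + 0)
  coeff-Ψ-below-*P {π} bot≢π w = begin
    coeff (Ψ P (below P π) (rank π) *P a[b-a]^ π) w
      ≡⟨ coeff-sumP-if-*P (isChainIn P (below P π)) _ Ss (a[b-a]^ π) w ⟩
    ∑ Ss (λ S → if C₀ S then coeff (wtRanks P (rank π) (chainRanks P (rank π) S) *P a[b-a]^ π) w else + 0)
      ≡⟨ ∑-cong Ss per-chain ⟩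
    ∑ Ss (λ S → σ * (if C₀ S then F S + F (S [ π ]≔ true) else + 0))
      ≡⟨ ∑-*ˡ Ss σ _ ⟩
    σ * ∑ Ss (λ S → if C₀ S then F S + F (S [ π ]≔ true) else + 0)
      ≡⟨ cong (σ *_) (∑-chains-below-add-top F bot≢π) ⟩
    σ * ∑ Ss (λ S → if isChainIn P (closedBelow π) S then F S else + 0) ∎
    where
    open ≡-Reasoning
    Ss = subsets P m
    C₀ = isChainIn P (below P π)
    σ = sign P (corank π ∸ 1)
    F : Vec Bool m → ℤ
    F S = coeff (chainWeight S) w
    per-chain : ∀ S → (if C₀ S then coeff (wtRanks P (rank π) (chainRanks P (rank π) S) *P a[b-a]^ π) w else + 0)
                      ≡ σ * (if C₀ S then F S + F (S [ π ]≔ true) else + 0)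
    per-chain S with C₀ S in isChain
    ... | true  = coeff-wt-below-*P bot≢π (to (T-isChainIn _ S) (subst T (sym isChain) tt)) w
    ... | false = sym (ℤ.*-zeroʳ σ)

proposition3p2 : (n : ℕ) (P : FinPoset) → IsGradedPoset P n → (L : IsLattice P) → IsEulerian P n →
    (ν : Fin (FinPoset.m P)) → _<_ P (FinPoset.bot P) ν →
    _≈P_ (Ψ P (Λ_ P L ν) (suc n)) (rhs P n ν)
proposition3p2 n P G L E ν 0̂<ν w = begin
  coeff (Ψ P (Λ_ P L ν) (suc n)) w
    ≡⟨ coeff-sumP-if (isChainIn P (Λ_ P L ν)) chainWeight Ss w ⟩
  ∑ Ss (λ S → if isChainIn P (Λ_ P L ν) S then F S else + 0)
    ≡⟨ ∑-chains-Λ ν F ⟩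
  ∑ πs (λ π → if leq ν π then σ π * ∑ Ss (λ S → if isChainIn P (closedBelow π) S then F S else + 0) else + 0)
    ≡⟨ ∑-cong πs above-ν ⟨
  ∑ πs (λ π → if leq ν π then coeff (Ψ P (below P π) (rank π) *P a[b-a]^ π) w else + 0)
    ≡⟨ coeff-sumP-if (leq ν) _ πs w ⟨
  coeff (rhs P n ν) w ∎
  where
  open ≡-Reasoning
  open FinPoset P
  open GradedPoset G
  open IntervalChains G
  open EulerianLattice G L E
  open LowerIntervals G
  Ss = subsets P m
  πs = allFin m
  F : Vec Bool m → ℤ
  F S = coeff (chainWeight S) w
  σ : Fin m → ℤ
  σ π = sign P (corank π ∸ 1)
  above-ν : ∀ π → (if leq ν π then coeff (Ψ P (below P π) (rank π) *P a[b-a]^ π) w else + 0)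
                  ≡ (if leq ν π then σ π * ∑ Ss (λ S → if isChainIn P (closedBelow π) S then F S else + 0) else + 0)
  above-ν π with leq ν π in ν≼π
  ... | true  = coeff-Ψ-below-*P (bot≢above 0̂<ν (subst T (sym ν≼π) tt)) w
  ... | false = refl
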